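{- Let $m\ge 3$ and $1<c_2<c_3<\cdots<c_m<c_{m+1}$ be natural numbers, and let $\$_1=\langle 1,c_2,c_3\rangle$, $\$_2=\langle 1,c_2,\dots,c_m\rangle$ and $\$_3=\langle 1,c_2,\dots,c_m,c_{m+1}\rangle$ be three tight coin systems such that $\$_1$ is canonical and both $\$_2$ and $\$_3$ are non-canonical. Set $c_1=1$, $c_0=0$ and $d_i=c_i-c_{i-1}$ for $1\le i\le m+1$. If no number of the form $c_m+c_i$ with $2\le i\le m$ and $c_m+c_i>c_{m+1}$ is a counterexample of $\$_3$, then $d_{m+1}=\max\{d_i : 1\le i\le m+1\}$.
   Context: A coin system is a tuple $\$=\langle c_1,\dots,c_m\rangle$ of natural numbers with $1=c_1<c_2<\cdots<c_m$. A representation of $x$ is a tuple $(\alpha_1,\dots,\alpha_m)$ of natural numbers with $\sum_i\alpha_ic_i=x$, of size $\sum_i\alpha_i$. The greedy representation $\mathrm{GRD}_{\$}(x)$ is the representation with $\sum_{j<i}\alpha_jc_j<c_i$ for all $2\le i\le m$; $\mathrm{OPT}_{\$}(x)$ is a representation of minimum size. A counterexample of $\$$ is a natural number $x$ with $|\mathrm{GRD}_{\$}(x)|>|\mathrm{OPT}_{\$}(x)|$; $\$$ is canonical if it has no counterexample and non-canonical otherwise. $\$$ is tight if it has no counterexample smaller than its largest coin $c_m$. -}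

module Defs where

open import Data.Nat using (ℕ; zero; suc; _+_; _*_; _∸_; _≤_; _<_)
open import Data.Fin using (Fin; toℕ; inject)
import Data.Fin as Fin
open import Data.Product using (Σ; _×_)
open import Relation.Nullary using (¬_)
open import Relation.Binary.PropositionalEquality using (_≡_)

sumFin : (n : ℕ) → (Fin n → ℕ) → ℕ
sumFin zero    f = 0
sumFin (suc n) f = f Fin.zero + sumFin n (λ j → f (Fin.suc j))

-- A coin system with k coins: coin i is c_{i+1} (0-based Fin index).
Coins : ℕ → Set
Coins k = Fin k → ℕ

Rep : ℕ → Set
Rep k = Fin k → ℕ

value : ∀ {k} → Coins k → Rep k → ℕ
value {k} c α = sumFin k (λ i → α i * c i)

size : ∀ {k} → Rep k → ℕ
size {k} α = sumFin k α

IsRep : ∀ {k} → Coins k → Rep k → ℕ → Set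
IsRep c α x = value c α ≡ x

prefixValue : ∀ {k} → Coins k → Rep k → Fin k → ℕ
prefixValue c α i = sumFin (toℕ i) (λ j → α (inject j) * c (inject j))

-- greedy representation: Σ_{j<i} α_j c_j < c_i for every coin i ≥ 2
-- (0-based: every index i with toℕ i ≥ 1)
IsGreedy : ∀ {k} → Coins k → Rep k → ℕ → Set
IsGreedy c α x = IsRep c α x × (∀ i → 1 ≤ toℕ i → prefixValue c α i < c i)

IsOpt : ∀ {k} → Coins k → Rep k → ℕ → Set
IsOpt c α x = IsRep c α x × (∀ β → IsRep c β x → size α ≤ size β)

Counterexample : ∀ {k} → Coins k → ℕ → Set
Counterexample {k} c x =
  Σ (Rep k) λ g → Σ (Rep k) λ o → IsGreedy c g x × IsOpt c o x × size o < size g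

Canonical : ∀ {k} → Coins k → Set
Canonical c = ∀ x → ¬ Counterexample c x

largest : ∀ {k} → Coins k → ℕ
largest {zero}  c = 0
largest {suc k} c = c (Fin.fromℕ k)

Tight : ∀ {k} → Coins k → Set
Tight c = ∀ x → x < largest c → ¬ Counterexample c x

prefix : (ℕ → ℕ) → (k : ℕ) → Coins k
prefix c k i = c (suc (toℕ i))

-- Suppose some earlier gap d_{p+1} (2 ≤ p + 1 ≤ m) exceeds the last gap d_{m+1}, and put
-- x = c_m + c_{p+1}. Then c_{m+1} < x < 2 c_{m+1}, so x = c_m + c_{p+1} is optimal with two
-- coins, while the greedy representation takes one coin c_{m+1} and must then represent
-- x − c_{m+1} = c_{p+1} − d_{m+1}, which lies strictly between c_p and c_{p+1}; it is neither 0
-- nor a coin, so greedy needs at least three coins. Thus x would be a counterexample of $_3 of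
-- the excluded form.
module Submission where

open import Defs
open import Data.Nat
open import Data.Nat.Properties
open import Data.Nat.DivMod using (_/_; _%_; m≡m%n+[m/n]*n; m%n<n)
open import Data.Fin using (Fin; toℕ)
import Data.Fin as Fin
open import Data.Fin.Properties using (toℕ<n; toℕ-inject)
open import Data.Product using (∃-syntax; _×_; _,_; proj₁; proj₂)
open import Data.Sum using (_⊎_; inj₁; inj₂)
open import Data.Empty using (⊥; ⊥-elim)
open import Function using (_∘_)
open import Relation.Nullary using (¬_; yes; no)
open import Relation.Binary.PropositionalEquality
open import Algebra.Properties.CommutativeSemigroup +-commutativeSemigroup using (interchange; x∙yz≈y∙xz)

-- Σ_{t<n} h t peeling off the last index (sumFin peels off the first), as the greedy recursion needs.

sumBelow : ℕ → (ℕ → ℕ) → ℕ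
sumBelow zero    h = 0
sumBelow (suc n) h = sumBelow n h + h n

sumBelow-cong : ∀ n {h h′ : ℕ → ℕ} → (∀ t → t < n → h t ≡ h′ t) → sumBelow n h ≡ sumBelow n h′
sumBelow-cong zero    eq = refl
sumBelow-cong (suc n) eq = cong₂ _+_ (sumBelow-cong n (λ t t<n → eq t (m<n⇒m<1+n t<n))) (eq n (n<1+n n))

sumBelow-+ : ∀ n (h h′ : ℕ → ℕ) → sumBelow n (λ t → h t + h′ t) ≡ sumBelow n h + sumBelow n h′
sumBelow-+ zero    h h′ = refl
sumBelow-+ (suc n) h h′ =
  trans (cong (_+ (h n + h′ n)) (sumBelow-+ n h h′)) (interchange (sumBelow n h) (sumBelow n h′) (h n) (h′ n))

sumBelow-suc : ∀ n (h : ℕ → ℕ) → sumBelow (suc n) h ≡ h 0 + sumBelow n (h ∘ suc)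
sumBelow-suc zero    h = +-comm 0 (h 0)
sumBelow-suc (suc n) h = trans (cong (_+ h (suc n)) (sumBelow-suc n h)) (+-assoc (h 0) _ _)

sumFin≡sumBelow : ∀ n (f : Fin n → ℕ) (h : ℕ → ℕ) → (∀ j → f j ≡ h (toℕ j))
  → sumFin n f ≡ sumBelow n h
sumFin≡sumBelow zero    f h eq = refl
sumFin≡sumBelow (suc n) f h eq =
  trans (cong₂ _+_ (eq Fin.zero) (sumFin≡sumBelow n (f ∘ Fin.suc) (h ∘ suc) (eq ∘ Fin.suc)))
        (sym (sumBelow-suc n h))

_[_≔_] : (ℕ → ℕ) → ℕ → ℕ → ℕ → ℕ
(h [ u ≔ v ]) t with t ≟ u
... | yes _ = v
... | no  _ = h t

update-≡ : ∀ h u v → (h [ u ≔ v ]) u ≡ v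
update-≡ h u v with u ≟ u
... | yes _   = refl
... | no  u≢u = ⊥-elim (u≢u refl)

update-≢ : ∀ h u v {t} → t ≢ u → (h [ u ≔ v ]) t ≡ h t
update-≢ h u v {t} t≢u with t ≟ u
... | yes t≡u = ⊥-elim (t≢u t≡u)
... | no  _   = refl

update-< : ∀ h u v {t} → t < u → (h [ u ≔ v ]) t ≡ h t
update-< h u v t<u = update-≢ h u v (<⇒≢ t<u)

δ : ℕ → ℕ → ℕ
δ u = (λ _ → 0) [ u ≔ 1 ]

sumBelow-δ* : ∀ n u (h : ℕ → ℕ) → u < n → sumBelow n (λ t → δ u t * h t) ≡ h u
sumBelow-δ* (suc n) u h u<1+n with m≤n⇒m<n∨m≡n (s≤s⁻¹ u<1+n)
... | inj₁ u<n = begin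
  sumBelow n (λ t → δ u t * h t) + δ u n * h n
    ≡⟨ cong (λ k → sumBelow n (λ t → δ u t * h t) + k * h n) (update-≢ _ u 1 (>⇒≢ u<n)) ⟩
  sumBelow n (λ t → δ u t * h t) + 0
    ≡⟨ +-identityʳ _ ⟩
  sumBelow n (λ t → δ u t * h t)
    ≡⟨ sumBelow-δ* n u h u<n ⟩
  h u ∎
  where open ≡-Reasoning
... | inj₂ refl = begin
  sumBelow u (λ t → δ u t * h t) + δ u u * h u ≡⟨ cong₂ _+_ below-u (cong (_* h u) (update-≡ _ u 1)) ⟩
  0 + 1 * h u                                  ≡⟨ *-identityˡ (h u) ⟩
  h u                                          ∎
  where
  open ≡-Reasoning
  below-u : sumBelow u (λ t → δ u t * h t) ≡ 0
  below-u = trans (sumBelow-cong u (λ t t<u → cong (_* h t) (update-< _ u 1 t<u))) (zeros u)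
    where
    zeros : ∀ k → sumBelow k (λ _ → 0) ≡ 0
    zeros zero    = refl
    zeros (suc k) = trans (+-identityʳ _) (zeros k)

sumBelow-δ+δ* : ∀ n u v (h : ℕ → ℕ) → u < n → v < n
  → sumBelow n (λ t → (δ u t + δ v t) * h t) ≡ h u + h v
sumBelow-δ+δ* n u v h u<n v<n = begin
  sumBelow n (λ t → (δ u t + δ v t) * h t)
    ≡⟨ sumBelow-cong n (λ t _ → *-distribʳ-+ (h t) (δ u t) (δ v t)) ⟩
  sumBelow n (λ t → δ u t * h t + δ v t * h t)
    ≡⟨ sumBelow-+ n _ _ ⟩
  sumBelow n (λ t → δ u t * h t) + sumBelow n (λ t → δ v t * h t)
    ≡⟨ cong₂ _+_ (sumBelow-δ* n u h u<n) (sumBelow-δ* n v h v<n) ⟩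
  h u + h v ∎
  where open ≡-Reasoning

valueBelow : ℕ → (ℕ → ℕ) → (ℕ → ℕ) → ℕ
valueBelow n a g = sumBelow n (λ t → g t * a t)

IsGreedyBelow : ℕ → (ℕ → ℕ) → (ℕ → ℕ) → ℕ → Set
IsGreedyBelow n a g x = valueBelow n a g ≡ x × (∀ i → 1 ≤ i → i < n → valueBelow i a g < a i)

value-toℕ : ∀ n (a g : ℕ → ℕ) → value {n} (a ∘ toℕ) (g ∘ toℕ) ≡ valueBelow n a g
value-toℕ n a g = sumFin≡sumBelow n _ _ (λ _ → refl)

size-toℕ : ∀ n (g : ℕ → ℕ) → size {n} (g ∘ toℕ) ≡ sumBelow n g
size-toℕ n g = sumFin≡sumBelow n _ _ (λ _ → refl)

isGreedy-toℕ : ∀ n (a g : ℕ → ℕ) x → IsGreedyBelow n a g x → IsGreedy {n} (a ∘ toℕ) (g ∘ toℕ) x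
isGreedy-toℕ n a g x (val , below) =
  trans (value-toℕ n a g) val ,
  λ i 1≤i → subst (_< a (toℕ i)) (sym (prefixValue-toℕ i)) (below (toℕ i) 1≤i (toℕ<n i))
  where
  prefixValue-toℕ : ∀ i → prefixValue (a ∘ toℕ) (g ∘ toℕ) i ≡ valueBelow (toℕ i) a g
  prefixValue-toℕ i = sumFin≡sumBelow (toℕ i) _ _ (λ j → cong (λ t → g t * a t) (toℕ-inject j))

greedy-exists : ∀ n (a : ℕ → ℕ) → a 0 ≡ 1 → (∀ t → t ≤ n → 0 < a t)
  → ∀ x → ∃[ g ] IsGreedyBelow (suc n) a g x
greedy-exists zero a a0 pos x = (λ _ → x) , trans (cong (x *_) a0) (*-identityʳ x) , no-middle-coin
  where
  no-middle-coin : ∀ i → 1 ≤ i → i < 1 → valueBelow i a (λ _ → x) < a i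
  no-middle-coin (suc i) _ (s≤s ())
greedy-exists (suc n) a a0 pos x = g′ , value′ , below′
  where
  instance
    top≢0 : NonZero (a (suc n))
    top≢0 = >-nonZero (pos (suc n) ≤-refl)
  rest : ∃[ g ] IsGreedyBelow (suc n) a g (x % a (suc n))
  rest = greedy-exists n a a0 (λ t t≤n → pos t (m≤n⇒m≤1+n t≤n)) (x % a (suc n))

  g g′ : ℕ → ℕ
  g = proj₁ rest
  g′ = g [ suc n ≔ x / a (suc n) ]

  agrees : ∀ i → i ≤ suc n → valueBelow i a g′ ≡ valueBelow i a g
  agrees i i≤1+n = sumBelow-cong i (λ t t<i → cong (_* a t) (update-< g (suc n) _ (<-≤-trans t<i i≤1+n)))

  remainder : valueBelow (suc n) a g′ ≡ x % a (suc n)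
  remainder = trans (agrees (suc n) ≤-refl) (proj₁ (proj₂ rest))

  value′ : valueBelow (suc (suc n)) a g′ ≡ x
  value′ = begin
    valueBelow (suc n) a g′ + g′ (suc n) * a (suc n)
      ≡⟨ cong₂ _+_ remainder (cong (_* a (suc n)) (update-≡ g (suc n) _)) ⟩
    x % a (suc n) + x / a (suc n) * a (suc n)
      ≡⟨ m≡m%n+[m/n]*n x (a (suc n)) ⟨
    x ∎
    where open ≡-Reasoning

  below′ : ∀ i → 1 ≤ i → i < suc (suc n) → valueBelow i a g′ < a i
  below′ i 1≤i i<2+n with m≤n⇒m<n∨m≡n (s≤s⁻¹ i<2+n)
  ... | inj₁ i<1+n = subst (_< a i) (sym (agrees i (<⇒≤ i<1+n))) (proj₂ (proj₂ rest) i 1≤i i<1+n)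
  ... | inj₂ refl  = subst (_< a (suc n)) (sym remainder) (m%n<n x (a (suc n)))

valueBelow-size≡0 : ∀ n (a g : ℕ → ℕ) → sumBelow n g ≡ 0 → valueBelow n a g ≡ 0
valueBelow-size≡0 zero    a g _  = refl
valueBelow-size≡0 (suc n) a g eq =
  cong₂ _+_ (valueBelow-size≡0 n a g (m+n≡0⇒m≡0 _ eq)) (cong (_* a n) (m+n≡0⇒n≡0 (sumBelow n g) eq))

valueBelow-size≤1 : ∀ n (a g : ℕ → ℕ) → sumBelow n g ≤ 1
  → valueBelow n a g ≡ 0 ⊎ ∃[ t ] t < n × valueBelow n a g ≡ a t
valueBelow-size≤1 zero    a g _ = inj₁ refl
valueBelow-size≤1 (suc n) a g size≤1 with g n
... | zero with valueBelow-size≤1 n a g (subst (_≤ 1) (+-identityʳ _) size≤1)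
...   | inj₁ eq           = inj₁ (trans (+-identityʳ _) eq)
...   | inj₂ (t , t<n , eq) = inj₂ (t , m<n⇒m<1+n t<n , trans (+-identityʳ _) eq)
valueBelow-size≤1 (suc n) a g size≤1 | suc zero =
  inj₂ (n , n<1+n n , cong₂ _+_ (valueBelow-size≡0 n a g (n≤0⇒n≡0 (+-cancelʳ-≤ 1 _ 0 size≤1)))
                                (*-identityˡ (a n)))
valueBelow-size≤1 (suc n) a g size≤1 | suc (suc k) =
  ⊥-elim (1+n≰n (≤-trans (s≤s (s≤s z≤n)) (≤-trans (m≤n+m (suc (suc k)) (sumBelow n g)) size≤1)))

value≤size*bound : ∀ {k} (c : Coins k) (α : Rep k) B → (∀ i → c i ≤ B) → value c α ≤ size α * B
value≤size*bound {zero}  c α B bound = z≤n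
value≤size*bound {suc k} c α B bound = begin
  α Fin.zero * c Fin.zero + value (c ∘ Fin.suc) (α ∘ Fin.suc)
    ≤⟨ +-mono-≤ (*-monoʳ-≤ (α Fin.zero) (bound Fin.zero))
                (value≤size*bound (c ∘ Fin.suc) (α ∘ Fin.suc) B (bound ∘ Fin.suc)) ⟩
  α Fin.zero * B + size (α ∘ Fin.suc) * B
    ≡⟨ *-distribʳ-+ B (α Fin.zero) _ ⟨
  size α * B ∎
  where open ≤-Reasoning

above-largest⇒2≤size : ∀ {k} (c : Coins k) (β : Rep k) B x → (∀ i → c i ≤ B) → B < x
  → IsRep c β x → 2 ≤ size β
above-largest⇒2≤size c β B _ bound B<x refl with 2 ≤? size β
... | yes 2≤size = 2≤size
... | no  2≰size = ⊥-elim (<⇒≱ B<x (begin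
  value c β  ≤⟨ value≤size*bound c β B bound ⟩
  size β * B ≤⟨ *-monoˡ-≤ B (s≤s⁻¹ (≰⇒> 2≰size)) ⟩
  1 * B      ≡⟨ *-identityˡ B ⟩
  B          ∎))
  where open ≤-Reasoning

quotient≡1 : ∀ {r b x} q → r + q * b ≡ x → r < b → b < x → x < b + b → q ≡ 1
quotient≡1 {r}     zero          refl r<b b<r+0 _ = ⊥-elim (<-asym r<b (subst (_ <_) (+-identityʳ r) b<r+0))
quotient≡1         (suc zero)    _    _   _     _ = refl
quotient≡1 {r} {b} (suc (suc q)) refl _   _     x<b+b =
  ⊥-elim (<⇒≱ x<b+b (≤-trans (+-monoʳ-≤ b (m≤m+n b (q * b))) (m≤n+m _ r)))

-- In the notation of the theorem a t = c_{t+1} and m = n + 1, so the last gap d_{m+1} is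
-- a (suc n) ∸ a n and the gap d_{q+2} is a (suc q) ∸ a q.
module LargeGap (n : ℕ) (a : ℕ → ℕ) (a0 : a 0 ≡ 1) (increasing : ∀ t → t ≤ n → a t < a (suc t)) where

  coins : Coins (suc (suc n))
  coins i = a (toℕ i)

  asRep : (ℕ → ℕ) → Rep (suc (suc n))
  asRep h = h ∘ toℕ

  mono : ∀ {s t} → s ≤ t → t ≤ suc n → a s ≤ a t
  mono s≤t = mono′ (≤⇒≤′ s≤t)
    where
    mono′ : ∀ {s t} → s ≤′ t → t ≤ suc n → a s ≤ a t
    mono′ ≤′-refl          _     = ≤-refl
    mono′ (≤′-step s≤′t) t<2+n = ≤-trans (mono′ s≤′t (<⇒≤ t<2+n)) (<⇒≤ (increasing _ (s≤s⁻¹ t<2+n)))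

  positive : ∀ t → t ≤ suc n → 0 < a t
  positive t t≤1+n = subst (_≤ a t) a0 (mono z≤n t≤1+n)

  no-coin-between : ∀ {q t} → q ≤ n → t ≤ suc n → a q < a t → a t < a (suc q) → ⊥
  no-coin-between {q} {t} q≤n t≤1+n aq<at at<aq+1 with t ≤? q
  ... | yes t≤q = <⇒≱ aq<at (mono t≤q (m≤n⇒m≤1+n q≤n))
  ... | no  t≰q = <⇒≱ at<aq+1 (mono (≰⇒> t≰q) t≤1+n)

  module _ (q : ℕ) (q<n : suc q ≤ n) (early>last : a (suc n) ∸ a n < a (suc q) ∸ a q) where

    x : ℕ
    x = a n + a (suc q)

    last-step : a n + (a (suc n) ∸ a n) ≡ a (suc n)
    last-step = m+[n∸m]≡n (<⇒≤ (increasing n ≤-refl))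

    early-step : a q + (a (suc q) ∸ a q) ≡ a (suc q)
    early-step = m+[n∸m]≡n (<⇒≤ (increasing q (<⇒≤ q<n)))

    top<x : a (suc n) < x
    top<x = subst (_< x) last-step (+-monoʳ-< (a n) (<-≤-trans early>last (m∸n≤m (a (suc q)) (a q))))

    x<2*top : x < a (suc n) + a (suc n)
    x<2*top = +-mono-<-≤ (increasing n ≤-refl) (mono (m≤n⇒m≤1+n q<n) ≤-refl)

    greedy : ∃[ g ] IsGreedyBelow (suc (suc n)) a g x
    greedy = greedy-exists (suc n) a a0 positive x

    g : ℕ → ℕ
    g = proj₁ greedy

    remainder : ℕ
    remainder = valueBelow (suc n) a g

    greedy-value : remainder + g (suc n) * a (suc n) ≡ x
    greedy-value = proj₁ (proj₂ greedy)

    remainder<top : remainder < a (suc n)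
    remainder<top = proj₂ (proj₂ greedy) (suc n) (s≤s z≤n) ≤-refl

    one-top-coin : g (suc n) ≡ 1
    one-top-coin = quotient≡1 (g (suc n)) greedy-value remainder<top top<x x<2*top

    remainder+last-gap : remainder + (a (suc n) ∸ a n) ≡ a (suc q)
    remainder+last-gap = +-cancelˡ-≡ (a n) _ _ (begin
      a n + (remainder + (a (suc n) ∸ a n)) ≡⟨ x∙yz≈y∙xz (a n) remainder _ ⟩
      remainder + (a n + (a (suc n) ∸ a n)) ≡⟨ cong (remainder +_) last-step ⟩
      remainder + a (suc n)                 ≡⟨ cong (remainder +_) (*-identityˡ (a (suc n))) ⟨
      remainder + 1 * a (suc n)             ≡⟨ cong (λ k → remainder + k * a (suc n)) one-top-coin ⟨
      remainder + g (suc n) * a (suc n)     ≡⟨ greedy-value ⟩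
      x                                     ∎)
      where open ≡-Reasoning

    aq<remainder : a q < remainder
    aq<remainder = +-cancelʳ-< (a (suc q) ∸ a q) (a q) remainder
      (subst (_< remainder + (a (suc q) ∸ a q)) (trans remainder+last-gap (sym early-step))
             (+-monoʳ-< remainder early>last))

    remainder<aq+1 : remainder < a (suc q)
    remainder<aq+1 = subst (remainder <_) remainder+last-gap (m<m+n remainder (m<n⇒0<n∸m (increasing n ≤-refl)))

    -- The remainder is neither 0 nor a coin, so greedy spends at least two coins on it.
    2≤size-below-top : 2 ≤ sumBelow (suc n) g
    2≤size-below-top with 2 ≤? sumBelow (suc n) g
    ... | yes 2≤ = 2≤
    ... | no  2≰ with valueBelow-size≤1 (suc n) a g (s≤s⁻¹ (≰⇒> 2≰))
    ...   | inj₁ remainder≡0 = ⊥-elim (n≮0 (subst (a q <_) remainder≡0 aq<remainder))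
    ...   | inj₂ (t , t<1+n , remainder≡at) = ⊥-elim (no-coin-between (<⇒≤ q<n) (<⇒≤ t<1+n)
            (subst (a q <_) remainder≡at aq<remainder) (subst (_< a (suc q)) remainder≡at remainder<aq+1))

    two-coins : ℕ → ℕ
    two-coins t = δ n t + δ (suc q) t

    n<2+n : n < suc (suc n)
    n<2+n = m<n⇒m<1+n (n<1+n n)

    q+1<2+n : suc q < suc (suc n)
    q+1<2+n = s≤s (m≤n⇒m≤1+n q<n)

    size-two-coins : size (asRep two-coins) ≡ 2
    size-two-coins = begin
      size (asRep two-coins)
        ≡⟨ size-toℕ (suc (suc n)) two-coins ⟩
      sumBelow (suc (suc n)) two-coins
        ≡⟨ sumBelow-cong (suc (suc n)) (λ t _ → *-identityʳ (two-coins t)) ⟨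
      sumBelow (suc (suc n)) (λ t → two-coins t * 1)
        ≡⟨ sumBelow-δ+δ* (suc (suc n)) n (suc q) (λ _ → 1) n<2+n q+1<2+n ⟩
      2 ∎
      where open ≡-Reasoning

    two-coins-optimal : IsOpt coins (asRep two-coins) x
    two-coins-optimal =
      trans (value-toℕ (suc (suc n)) a two-coins) (sumBelow-δ+δ* (suc (suc n)) n (suc q) a n<2+n q+1<2+n) ,
      λ β β-rep → subst (_≤ size β) (sym size-two-coins)
        (above-largest⇒2≤size coins β (a (suc n)) x (λ i → mono (s≤s⁻¹ (toℕ<n i)) ≤-refl) top<x β-rep)

    size-two-coins<size-greedy : size (asRep two-coins) < size (asRep g)
    size-two-coins<size-greedy = begin-strict
      size (asRep two-coins)          ≡⟨ size-two-coins ⟩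
      2                               <⟨ +-monoˡ-≤ 1 2≤size-below-top ⟩
      sumBelow (suc n) g + 1          ≡⟨ cong (sumBelow (suc n) g +_) one-top-coin ⟨
      sumBelow (suc n) g + g (suc n)  ≡⟨ size-toℕ (suc (suc n)) g ⟨
      size (asRep g)                  ∎
      where open ≤-Reasoning

    large-gap⇒counterexample : Counterexample coins x
    large-gap⇒counterexample =
      asRep g , asRep two-coins , isGreedy-toℕ (suc (suc n)) a g x (proj₂ greedy) ,
      two-coins-optimal , size-two-coins<size-greedy

lemma2 : (m : ℕ) → 3 ≤ m → (c : ℕ → ℕ)
    → c 0 ≡ 0 → c 1 ≡ 1
    → (∀ i → 1 ≤ i → i ≤ m → c i < c (suc i))
    → Tight (prefix c 3) → Tight (prefix c m) → Tight (prefix c (suc m))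
    → Canonical (prefix c 3)
    → ¬ Canonical (prefix c m) → ¬ Canonical (prefix c (suc m))
    → (∀ i → 2 ≤ i → i ≤ m → c (suc m) < c m + c i
    → ¬ Counterexample (prefix c (suc m)) (c m + c i))
    → ∀ i → 1 ≤ i → i ≤ suc m → c i ∸ c (i ∸ 1) ≤ c (suc m) ∸ c m
lemma2 zero ()
lemma2 (suc n) _ c c0 c1 step _ _ _ _ _ _ _ (suc zero) _ _ =
  subst₂ (λ c₁ c₀ → c₁ ∸ c₀ ≤ c (suc (suc n)) ∸ c (suc n)) (sym c1) (sym c0)
    (m<n⇒0<n∸m (step (suc n) (s≤s z≤n) ≤-refl))
lemma2 (suc n) _ c _ c1 step _ _ _ _ _ _ excluded (suc (suc q)) _ i≤m+1
  with m≤n⇒m<n∨m≡n (s≤s⁻¹ (s≤s⁻¹ i≤m+1))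
... | inj₂ refl = ≤-refl
... | inj₁ q<n with c (suc (suc q)) ∸ c (suc q) ≤? c (suc (suc n)) ∸ c (suc n)
...   | yes early≤last = early≤last
...   | no  early≰last =
  ⊥-elim (excluded (suc (suc q)) (s≤s (s≤s z≤n)) (s≤s q<n)
                   (top<x q q<n early>last) (large-gap⇒counterexample q q<n early>last))
  where
  open LargeGap n (c ∘ suc) c1 (λ t t≤n → step (suc t) (s≤s z≤n) (s≤s t≤n))
  early>last = ≰⇒> early≰last
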